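{- Let $\{G_i\}$ be a family of connected graphs with a common induced subgraph $J$ with embeddings $J_i$, and let $H=\amalg\{(G_i|J_i)\}$. Then every $G_i$ is isometrically embedded in $H$ if and only if $\{(G_i|J_i)\}$ is isometric.
   Context: All graphs are finite, simple and non-null. $J$ is a common induced subgraph of the $G_i$ via injective maps $\iota_i:V(J)\to V(G_i)$ with $\iota_i(u)\iota_i(v)\in E(G_i)$ iff $uv\in E(J)$; $J_i$ is the induced subgraph of $G_i$ on $\iota_i(V(J))$, and for $a\in V(J)$ write $a^i=\iota_i(a)$. $H=\amalg\{(G_i|J_i)\}$ is obtained from the disjoint union of the $G_i$ by identifying, for each $a\in V(J)$, all the vertices $a^i$ into one vertex (adjacencies of each $G_i$ are preserved), and each $G_i$ is regarded as a subgraph of $H$. A subgraph $G'$ of $H$ is isometrically embedded in $H$ if $d_{G'}(u,v)=d_H(u,v)$ for all $u,v\in V(G')$. The family $\{(G_i|J_i)\}$ is isometric if $d_{G_i}(a^i,b^i)=d_{G_j}(a^j,b^j)$ for all $i,j$ and all $a,b\in V(J)$. -}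

module Defs where

open import Data.Nat using (ℕ; zero; suc; _≤_)
open import Data.Fin using (Fin; _≟_)
open import Data.Fin.Properties using (any?)
open import Data.Bool using (Bool; true)
open import Data.Product using (Σ; Σ-syntax; _×_; _,_; ∃)
open import Data.Sum using (_⊎_; inj₁; inj₂)
open import Relation.Nullary using (¬_; yes; no)
open import Relation.Binary.PropositionalEquality using (_≡_; subst)
open import Function.Definitions using (Injective)

record FinGraph : Set where
  field
    n     : ℕ
    adj   : Fin n → Fin n → Bool
    sym   : ∀ u v → adj u v ≡ adj v u
    irref : ∀ u → ¬ (adj u u ≡ true)
open FinGraph public

Vtx : FinGraph → Set
Vtx G = Fin (n G)

Adj : (G : FinGraph) → Vtx G → Vtx G → Set
Adj G u v = adj G u v ≡ true

data Walk {V : Set} (E : V → V → Set) : V → V → ℕ → Set where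
  here : ∀ {x} → Walk E x x 0
  step : ∀ {x y z k} → E x y → Walk E y z k → Walk E x z (suc k)

Dist : {V : Set} → (V → V → Set) → V → V → ℕ → Set
Dist E x y k = Walk E x y k × (∀ j → Walk E x y j → k ≤ j)

Connected : FinGraph → Set
Connected G = ∀ (u v : Vtx G) → ∃ λ k → Walk (Adj G) u v k

SameDist : {V W : Set} → (V → V → Set) → V → V → (W → W → Set) → W → W → Set
SameDist E x y F x' y' = ∀ k → (Dist E x y k → Dist F x' y' k) × (Dist F x' y' k → Dist E x y k)

record InducedEmb (J G : FinGraph) : Set where
  field
    ι       : Vtx J → Vtx G
    ι-inj   : Injective _≡_ _≡_ ι
    ι-adj   : ∀ a b → adj G (ι a) (ι b) ≡ adj J a b
open InducedEmb public

module Amalgam {m : ℕ} (J : FinGraph) (G : Fin m → FinGraph)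
               (e : (i : Fin m) → InducedEmb J (G i)) where

  InImage : (i : Fin m) → Vtx (G i) → Set
  InImage i v = Σ[ a ∈ Vtx J ] ι (e i) a ≡ v

  VH : Set
  VH = Vtx J ⊎ (Σ[ i ∈ Fin m ] Σ[ v ∈ Vtx (G i) ] ¬ InImage i v)

  EH : VH → VH → Set
  EH (inj₁ a) (inj₁ b) = Adj J a b
  EH (inj₁ a) (inj₂ (i , v , _)) = Adj (G i) (ι (e i) a) v
  EH (inj₂ (i , v , _)) (inj₁ a) = Adj (G i) v (ι (e i) a)
  EH (inj₂ (i , v , _)) (inj₂ (j , w , _)) =
    Σ[ p ∈ i ≡ j ] Adj (G j) (subst (λ t → Vtx (G t)) p v) w

  emb : (i : Fin m) → Vtx (G i) → VH
  emb i v with any? (λ a → ι (e i) a ≟ v)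
  ... | yes (a , _) = inj₁ a
  ... | no ¬p = inj₂ (i , v , ¬p)

  IsometricallyEmbedded : Fin m → Set
  IsometricallyEmbedded i =
    ∀ (u v : Vtx (G i)) → SameDist (Adj (G i)) u v EH (emb i u) (emb i v)

  IsometricFamily : Set
  IsometricFamily = ∀ (i j : Fin m) (a b : Vtx J) →
    SameDist (Adj (G i)) (ι (e i) a) (ι (e i) b) (Adj (G j)) (ι (e j) a) (ι (e j) b)

-- A walk in H between vertices of G_i decomposes into stretches inside G_i
-- and excursions into other G_j that leave and re-enter through vertices of J.
-- If the family is isometric, each excursion from a^j to b^j can be replaced by
-- a walk from a^i to b^i in G_i that is no longer, so H creates no shortcuts
-- between vertices of G_i. Conversely, if every G_i sits isometrically in H,
-- then d_{G_i}(a^i, b^i) = d_H(a, b) = d_{G_j}(a^j, b^j).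
module Submission where

open import Defs hiding (sym)
open import Data.Nat using (ℕ; _≥_; zero; suc; _+_; _≤_; _<_; s≤s)
open import Data.Nat.Properties using (≤-refl; ≤-trans; ≤-antisym; ≮⇒≥; <⇒≤; +-mono-≤; anyUpTo?)
open import Data.Nat.Induction using (<-rec)
open import Data.Fin using (Fin; _≟_)
open import Data.Fin.Properties using (any?)
open import Data.Bool using (true)
import Data.Bool as Bool
open import Data.Product using (Σ; ∃-syntax; ∃₂; _×_; _,_; proj₁; proj₂)
open import Data.Sum using (_⊎_; inj₁; inj₂)
open import Data.Empty using (⊥-elim)
open import Relation.Nullary using (Dec; yes; no)
open import Relation.Nullary.Decidable using (_×-dec_)
open import Relation.Unary using (Decidable)
open import Relation.Binary.PropositionalEquality using (_≡_; refl; sym; trans; cong; subst; subst₂)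

module _ {V : Set} {E : V → V → Set} where

  _++ʷ_ : ∀ {x y z a b} → Walk E x y a → Walk E y z b → Walk E x z (a + b)
  here       ++ʷ w₂ = w₂
  step e w₁ ++ʷ w₂ = step e (w₁ ++ʷ w₂)

  Walk≤ : V → V → ℕ → Set
  Walk≤ x y ℓ = ∃[ k ] k ≤ ℓ × Walk E x y k

  walk⇒walk≤ : ∀ {x y ℓ} → Walk E x y ℓ → Walk≤ x y ℓ
  walk⇒walk≤ w = _ , ≤-refl , w

  step≤ : ∀ {x y z ℓ} → E x y → Walk≤ y z ℓ → Walk≤ x z (suc ℓ)
  step≤ e (k , k≤ℓ , w) = suc k , s≤s k≤ℓ , step e w

  _++≤_ : ∀ {x y z a b} → Walk≤ x y a → Walk≤ y z b → Walk≤ x z (a + b)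
  (k₁ , k₁≤a , w₁) ++≤ (k₂ , k₂≤b , w₂) = k₁ + k₂ , +-mono-≤ k₁≤a k₂≤b , w₁ ++ʷ w₂

Walk-map : ∀ {V W : Set} {E : V → V → Set} {F : W → W → Set} (f : V → W) →
           (∀ {x y} → E x y → F (f x) (f y)) →
           ∀ {x y k} → Walk E x y k → Walk F (f x) (f y) k
Walk-map f f-hom here       = here
Walk-map f f-hom (step e w) = step (f-hom e) (Walk-map f f-hom w)

walk? : ∀ {n} {E : Fin n → Fin n → Set} → (∀ x y → Dec (E x y)) →
        ∀ k x y → Dec (Walk E x y k)
walk? E? zero x y with x ≟ y
... | yes refl = yes here
... | no x≢y   = no λ { here → x≢y refl }
walk? E? (suc k) x y with any? (λ z → E? x z ×-dec walk? E? k z y)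
... | yes (z , e , w) = yes (step e w)
... | no ∄z           = no λ { (step {y = z} e w) → ∄z (z , e , w) }

least : ∀ {P : ℕ → Set} → Decidable P →
        ∀ ℓ → P ℓ → ∃[ k ] P k × k ≤ ℓ × (∀ j → P j → k ≤ j)
least {P} P? = <-rec Least search
  where
  Least : ℕ → Set
  Least ℓ = P ℓ → ∃[ k ] P k × k ≤ ℓ × (∀ j → P j → k ≤ j)

  search : ∀ ℓ → (∀ {j} → j < ℓ → Least j) → Least ℓ
  search ℓ rec pℓ with anyUpTo? P? ℓ
  ... | yes (j , j<ℓ , pj) =
    let k , pk , k≤j , minimal = rec j<ℓ pj in k , pk , ≤-trans k≤j (<⇒≤ j<ℓ) , minimal
  ... | no ∄j = ℓ , pℓ , ≤-refl , λ j pj → ≮⇒≥ (λ j<ℓ → ∄j (j , j<ℓ , pj))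

adj? : (G : FinGraph) → ∀ u v → Dec (Adj G u v)
adj? G u v = adj G u v Bool.≟ true

shortest : (G : FinGraph) {x y : Vtx G} {ℓ : ℕ} → Walk (Adj G) x y ℓ →
           ∃[ k ] Dist (Adj G) x y k × k ≤ ℓ
shortest G {x} {y} {ℓ} w with least (λ k → walk? (adj? G) k x y) ℓ w
... | k , wₖ , k≤ℓ , minimal = k , (wₖ , minimal) , k≤ℓ

module _ {V W : Set} {E : V → V → Set} {F : W → W → Set} where

  SameDist-sym : ∀ {x y x′ y′} → SameDist E x y F x′ y′ → SameDist F x′ y′ E x y
  SameDist-sym same k = proj₂ (same k) , proj₁ (same k)

  SameDist-trans : ∀ {U : Set} {D : U → U → Set} {x y x′ y′ x″ y″} →
                   SameDist E x y F x′ y′ → SameDist F x′ y′ D x″ y″ → SameDist E x y D x″ y″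
  SameDist-trans same same′ k =
    (λ d → proj₁ (same′ k) (proj₁ (same k) d)) , (λ d → proj₂ (same k) (proj₂ (same′ k) d))

  walk-maps⇒SameDist : ∀ {x y x′ y′} →
                       (∀ {k} → Walk E x y k → Walk F x′ y′ k) →
                       (∀ {ℓ} → Walk F x′ y′ ℓ → Walk≤ {E = E} x y ℓ) →
                       SameDist E x y F x′ y′
  walk-maps⇒SameDist {x} {y} {x′} {y′} to from k = there , back
    where
    there : Dist E x y k → Dist F x′ y′ k
    there (w , minimal) = to w , λ j wⱼ →
      let k′ , k′≤j , w′ = from wⱼ in ≤-trans (minimal k′ w′) k′≤j
    back : Dist F x′ y′ k → Dist E x y k
    back (w , minimal) with from w
    ... | k′ , k′≤k , w′ with ≤-antisym k′≤k (minimal k′ (to w′))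
    ...   | refl = w′ , λ j wⱼ → minimal j (to wⱼ)

SameDist⇒walk≤ : (G : FinGraph) {W : Set} {F : W → W → Set} {x y : Vtx G} {x′ y′ : W} →
                 SameDist (Adj G) x y F x′ y′ →
                 ∀ {ℓ} → Walk (Adj G) x y ℓ → Walk≤ {E = F} x′ y′ ℓ
SameDist⇒walk≤ G same w with shortest G w
... | k , d , k≤ℓ = k , k≤ℓ , proj₁ (proj₁ (same k) d)

module AmalgamProperties {m : ℕ} (J : FinGraph) (G : Fin m → FinGraph)
                         (e : (i : Fin m) → InducedEmb J (G i)) where
  open Amalgam J G e

  infix 4 _≡emb_
  _≡emb_ : ∀ {i} → VH → Vtx (G i) → Set
  _≡emb_     (inj₁ a)           v = ι (e _) a ≡ v
  _≡emb_ {i} (inj₂ (j , w , _)) v = Σ (j ≡ i) λ p → subst (λ t → Vtx (G t)) p w ≡ v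

  emb-spec : ∀ i v → emb i v ≡emb v
  emb-spec i v with any? (λ a → ι (e i) a ≟ v)
  ... | yes (a , ιa≡v) = ιa≡v
  ... | no _           = refl , refl

  emb-ι : ∀ i a → emb i (ι (e i) a) ≡ inj₁ a
  emb-ι i a with any? (λ a′ → ι (e i) a′ ≟ ι (e i) a)
  ... | yes (a′ , ιa′≡ιa) = cong inj₁ (ι-inj (e i) ιa′≡ιa)
  ... | no ∄a′            = ⊥-elim (∄a′ (a , refl))

  emb-adj : ∀ i {u v} → Adj (G i) u v → EH (emb i u) (emb i v)
  emb-adj i {u} {v} = edge (emb-spec i u) (emb-spec i v)
    where
    edge : ∀ {x y} → x ≡emb u → y ≡emb v → Adj (G i) u v → EH x y
    edge {inj₁ a} {inj₁ b} refl refl uv = trans (sym (ι-adj (e i) a b)) uv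
    edge {inj₁ _} {inj₂ _} refl (refl , refl) uv = uv
    edge {inj₂ _} {inj₁ _} (refl , refl) refl uv = uv
    edge {inj₂ _} {inj₂ _} (refl , refl) (refl , refl) uv = refl , uv

  isometric-on-J : ∀ {i} → IsometricallyEmbedded i → ∀ a b →
                   SameDist (Adj (G i)) (ι (e i) a) (ι (e i) b) EH (inj₁ a) (inj₁ b)
  isometric-on-J {i} isoᵢ a b =
    subst₂ (SameDist (Adj (G i)) _ _ EH) (emb-ι i a) (emb-ι i b) (isoᵢ _ _)

  isometricallyEmbedded⇒isometricFamily : (∀ i → IsometricallyEmbedded i) → IsometricFamily
  isometricallyEmbedded⇒isometricFamily iso i j a b =
    SameDist-trans (isometric-on-J (iso i) a b) (SameDist-sym (isometric-on-J (iso j) a b))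

  module Shortcut (iso : IsometricFamily) (i : Fin m) (v : Vtx (G i)) where

    Walkᵢ≤ : Vtx (G i) → Vtx (G i) → ℕ → Set
    Walkᵢ≤ = Walk≤ {E = Adj (G i)}

    -- The state of a walk in H towards v, read from its current vertex: from a
    -- vertex of G_j with j ≠ i we are in the middle of an excursion, which must
    -- return to G_i through some b ∈ J.
    ReturnsWithin : VH → ℕ → Set
    ReturnsWithin (inj₁ a) ℓ = Walkᵢ≤ (ι (e i) a) v ℓ
    ReturnsWithin (inj₂ (j , w , _)) ℓ =
      (Σ (j ≡ i) λ p → Walkᵢ≤ (subst (λ t → Vtx (G t)) p w) v ℓ)
      ⊎ (∃[ b ] ∃₂ λ l₁ l₂ → l₁ + l₂ ≡ ℓ ×
           Walk (Adj (G j)) w (ι (e j) b) l₁ × Walkᵢ≤ (ι (e i) b) v l₂)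

    returnsWithin : ∀ {x t ℓ} → Walk EH x t ℓ → t ≡emb v → ReturnsWithin x ℓ
    returnsWithin {inj₁ _} here refl = walk⇒walk≤ here
    returnsWithin {inj₂ _} here (refl , refl) = inj₁ (refl , walk⇒walk≤ here)
    returnsWithin {inj₁ a} (step {y = inj₁ b} ab w) t≡v =
      step≤ (trans (ι-adj (e i) a b) ab) (returnsWithin w t≡v)
    returnsWithin {inj₁ a} (step {y = inj₂ (j , _ , _)} ab w) t≡v with returnsWithin w t≡v
    ... | inj₁ (refl , r) = step≤ ab r
    ... | inj₂ (b , _ , _ , refl , w₁ , r) =
      SameDist⇒walk≤ (G j) (iso j i a b) (step ab w₁) ++≤ r
    returnsWithin {inj₂ _} (step {y = inj₁ b} ab w) t≡v =
      inj₂ (b , 1 , _ , refl , step ab here , returnsWithin w t≡v)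
    returnsWithin {inj₂ _} (step {y = inj₂ _} (refl , ab) w) t≡v with returnsWithin w t≡v
    ... | inj₁ (refl , r) = inj₁ (refl , step≤ ab r)
    ... | inj₂ (b , l₁ , l₂ , refl , w₁ , r) = inj₂ (b , suc l₁ , l₂ , refl , step ab w₁ , r)

    shortcut : ∀ u {ℓ} → Walk EH (emb i u) (emb i v) ℓ → Walkᵢ≤ u v ℓ
    shortcut u w = close (emb-spec i u) (returnsWithin w (emb-spec i v))
      where
      close : ∀ {x ℓ} → x ≡emb u → ReturnsWithin x ℓ → Walkᵢ≤ u v ℓ
      close {inj₁ _} refl r = r
      close {inj₂ _} (refl , refl) (inj₁ (refl , r)) = r
      close {inj₂ _} (refl , refl) (inj₂ (_ , _ , _ , refl , w₁ , r)) = walk⇒walk≤ w₁ ++≤ r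

  isometricFamily⇒isometricallyEmbedded : IsometricFamily → ∀ i → IsometricallyEmbedded i
  isometricFamily⇒isometricallyEmbedded iso i u v =
    walk-maps⇒SameDist (Walk-map (emb i) (emb-adj i)) (Shortcut.shortcut iso i v u)

lemma2 : ∀ {m : ℕ} (J : FinGraph) (G : Fin m → FinGraph)
           (e : (i : Fin m) → InducedEmb J (G i)) →
           n J ≥ 1 →
           (∀ i → n (G i) ≥ 1) →
           (∀ i → Connected (G i)) →
           ((∀ i → Amalgam.IsometricallyEmbedded J G e i) → Amalgam.IsometricFamily J G e)
           × (Amalgam.IsometricFamily J G e → (∀ i → Amalgam.IsometricallyEmbedded J G e i))
lemma2 J G e _ _ _ =
  isometricallyEmbedded⇒isometricFamily , isometricFamily⇒isometricallyEmbedded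
  where open AmalgamProperties J G e
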